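{- Fix $k\geq 2$, let $n$ be sufficiently large, and let $a=a(n)$, $s=s(n)$ be positive integers with $a=o(n)$, $s=o(n/a)$, and $a,s\gg k$ (i.e., $a,s\to\infty$). Partition $[n]=\{1,\dots,n\}$ into $a$ intervals of consecutive integers $I_1,\dots,I_a$ (in increasing order) whose sizes are as equal as possible, and let $$\mathcal{H}^n_{a,s}=\left\{ \{i_1, i_1+\ell, \dots, i_k, i_k+\ell\}: 1\leq \ell \leq s,\ \exists\, 1\leq b_1<\dots< b_k\leq a \text{ with } \{i_j, i_j+\ell\}\subseteq I_{b_j} \text{ for all } 1\leq j\leq k \right\}.$$ Then the pure simplicial complex whose set of facets is $\mathcal{H}^n_{a,s}$ is a $(2k-1)$-dimensional pseudomanifold with $n$ vertices and $\Theta(sn^k)$ facets.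
   Context: A pure simplicial complex is a pseudomanifold if every ridge (face of dimension one less than the facets) is contained in at most two facets. $\Theta$ is as $n\to\infty$ with $k$ fixed. -}

module Defs where

open import Data.Nat using (ℕ; zero; suc; pred; _+_; _*_; _∸_; _^_; _≤_; _<_)
open import Data.Fin using (Fin; toℕ)
import Data.Fin as F
open import Data.Fin.Subset using (Subset; _∈_; _⊆_; ∣_∣)
open import Data.Product using (Σ; ∃; _×_)
open import Data.Sum using (_⊎_)
open import Data.List using (List; length)
open import Data.List.Relation.Unary.Unique.Propositional using (Unique)
open import Data.List.Membership.Propositional using () renaming (_∈_ to _∈ₗ_)
open import Relation.Binary.PropositionalEquality using (_≡_)
open import Function.Bundles using (_⇔_)

LittleO : (ℕ → ℕ) → (ℕ → ℕ) → Set
LittleO f g = ∀ c → ∃ λ N → ∀ n → N ≤ n → c * f n ≤ g n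

TendsToInfinity : (ℕ → ℕ) → Set
TendsToInfinity f = ∀ c → ∃ λ N → ∀ n → N ≤ n → c ≤ f n

-- A partition of [n] = {1..n} into a intervals I_1,...,I_a of consecutive
-- integers in increasing order, given by endpoints e 0 = 0 ≤ e 1 ≤ ... ≤ e a = n,
-- I_b = { x : e (b-1) < x ≤ e b }, with sizes as equal as possible, i.e. each
-- size d = e (b+1) ∸ e b lies in {⌊n/a⌋, ⌈n/a⌉}  ⟺  a*d < n + a  and  n < a*d + a.
BalancedPartition : (n a : ℕ) → (ℕ → ℕ) → Set
BalancedPartition n a e =
  e 0 ≡ 0 × e a ≡ n ×
  (∀ b → b < a →
     e b ≤ e (suc b) ×
     a * (e (suc b) ∸ e b) < n + a ×
     n < a * (e (suc b) ∸ e b) + a)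

InBlock : (ℕ → ℕ) → ℕ → ℕ → Set
InBlock e b x = e (pred b) < x × x ≤ e b

-- Vertex x : Fin n represents the integer toℕ x + 1 ∈ [n].
-- F ∈ H^n_{a,s} (w.r.t. partition e).
IsFacet : (k n a s : ℕ) → (ℕ → ℕ) → Subset n → Set
IsFacet k n a s e F =
  Σ ℕ λ ℓ → 1 ≤ ℓ × ℓ ≤ s ×
  Σ (Fin k → ℕ) λ i → Σ (Fin k → ℕ) λ b →
    (∀ (j j′ : Fin k) → j F.< j′ → b j < b j′) ×
    (∀ (j : Fin k) → 1 ≤ b j × b j ≤ a ×
                     InBlock e (b j) (i j) × InBlock e (b j) (i j + ℓ)) ×
    (∀ (x : Fin n) → (x ∈ F) ⇔ (∃ λ (j : Fin k) → (suc (toℕ x) ≡ i j) ⊎ (suc (toℕ x) ≡ i j + ℓ)))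

IsPseudomanifoldWithVertices : (n d : ℕ) → (Subset n → Set) → Set
IsPseudomanifoldWithVertices n d Fac =
  (∀ F → Fac F → ∣ F ∣ ≡ suc d) ×
  (∀ (x : Fin n) → ∃ λ F → Fac F × x ∈ F) ×
  (∀ R → ∣ R ∣ ≡ d → ∀ F₁ F₂ F₃ → Fac F₁ → Fac F₂ → Fac F₃ →
     R ⊆ F₁ → R ⊆ F₂ → R ⊆ F₃ → (F₁ ≡ F₂) ⊎ (F₁ ≡ F₃) ⊎ (F₂ ≡ F₃))

EnumeratesFacets : {n : ℕ} → (Subset n → Set) → List (Subset n) → Set
EnumeratesFacets Fac fs = Unique fs × (∀ F → (F ∈ₗ fs) ⇔ Fac F)

-- A facet is a union of k pairs {i_j, i_j + ℓ} with one common shift ℓ, the j-th pair inside the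
-- interval I_{b_j}, b_1 < ⋯ < b_k; so it meets every interval in zero or two vertices and has 2k
-- vertices. Let a ridge R lie in the facet R ∪ {u₁} and let p be the partner of u₁ there. As k ≥ 2,
-- another pair of that facet lies in R, and it fixes the shift of every facet R ∪ {u}. In such a
-- facet the partner of p is not in R (the interval of p meets R ∪ {u₁} only in p and u₁), so it is
-- u, and u ∈ {p - ℓ, p + ℓ}: at most two facets contain R.
-- A facet is determined by ℓ ≤ s and (i_j) ∈ [n]^k, so there are at most s nᵏ of them. Conversely,
-- putting the j-th pair into the j-th of k disjoint runs of ⌊a/k⌋ consecutive intervals, starting
-- among the first ⌊n/a⌋ - s points of its interval, gives s (⌊a/k⌋ (⌊n/a⌋ - s))ᵏ ≥ s nᵏ / (8k)ᵏ
-- distinct facets once k ≤ a and 4 a s ≤ n.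

module Submission where

open import Defs
import Data.Bool as Bool
open import Data.Empty using (⊥-elim)
open import Data.Fin using (Fin; toℕ; fromℕ<)
import Data.Fin as Fin
import Data.Fin.Properties as Finₚ
open import Data.Fin.Subset using (Subset; _∈_; _∉_; _⊆_; _⊂_; _∪_; ⁅_⁆; ∣_∣; inside; outside)
open import Data.Fin.Subset.Properties
  using (_∈?_; ⊆-antisym; p⊂q⇒∣p∣<∣q∣; p⊆q⇒∣p∣≤∣q∣; x∈p∪q⁺; x∈p∪q⁻; x∈⁅x⁆; x∈⁅y⁆⇒x≡y)
open import Data.List
  using (List; []; _∷_; length; map; lookup; applyUpTo; upTo; tabulate; _++_;
         cartesianProduct; cartesianProductWith; filter; deduplicate)
open import Data.List.Properties
  using (length-map; length-++; length-applyUpTo; length-upTo; length-tabulate; length-filter; length-deduplicate)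
open import Data.List.Membership.Propositional using (lose) renaming (_∈_ to _∈ₗ_)
open import Data.List.Membership.Propositional.Properties
import Data.List.Relation.Unary.All as All
import Data.List.Relation.Unary.AllPairs as AllPairs
open import Data.List.Relation.Unary.Any as Any using (Any)
open import Data.List.Relation.Unary.Any.Properties using (lookup-index)
open import Data.List.Relation.Unary.Unique.Propositional using (Unique)
open import Data.List.Relation.Unary.Unique.Propositional.Properties
  using (map⁺; applyUpTo⁺₁; upTo⁺; tabulate⁺; ++⁺; cartesianProduct⁺; cartesianProductWith⁺)
open import Data.List.Relation.Unary.Unique.DecPropositional.Properties using (deduplicate-!)
open import Data.Nat
  using (ℕ; zero; suc; pred; _+_; _*_; _∸_; _^_; _≤_; _<_; _≟_; _≤?_; _<?_; z≤n; s≤s; NonZero; >-nonZero)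
open import Data.Nat.DivMod using (_/_; _%_; m≡m%n+[m/n]*n; m%n<n; m/n*n≤m; m*n/n≡m; /-monoˡ-≤; m≥n⇒m/n>0)
open import Data.Nat.Properties
open import Algebra.Properties.CommutativeSemigroup *-commutativeSemigroup using (x∙yz≈y∙xz)
open import Data.Nat.Tactic.RingSolver using (solve-∀)
open import Data.Product using (Σ; ∃; ∃₂; _×_; _,_; proj₁; proj₂; map₂)
open import Data.Sum using (_⊎_; inj₁; inj₂)
import Data.Sum as Sum
open import Data.Vec using (Vec) renaming ([] to []ᵥ; _∷_ to _∷ᵥ_)
import Data.Vec as Vec
import Data.Vec.Properties as Vecₚ
open import Data.Vec.Functional using (updateAt)
open import Data.Vec.Functional.Properties using (updateAt-updates; updateAt-minimal)
open import Function using (id)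
open import Function.Bundles using (_⇔_; mk⇔; Equivalence)
open import Relation.Binary.Definitions using (tri<; tri≈; tri>)
open import Relation.Binary.PropositionalEquality
open import Relation.Nullary using (¬_; Dec; yes; no; does; ¬?)
open import Relation.Nullary.Decidable using (_×-dec_; _⊎-dec_; _→-dec_; decidable-stable; dec-true)

-- Lists and finite subsets

module _ {A B : Set} where

  Unique⇒lookup-injective : {xs : List A} → Unique xs → ∀ {i j} → lookup xs i ≡ lookup xs j → i ≡ j
  Unique⇒lookup-injective {_ ∷ _} (_ AllPairs.∷ _) {Fin.zero} {Fin.zero} _ = refl
  Unique⇒lookup-injective {_ ∷ _} (x∉ AllPairs.∷ _) {Fin.zero} {Fin.suc j} eq =
    ⊥-elim (All.lookup x∉ (∈-lookup j) eq)
  Unique⇒lookup-injective {_ ∷ _} (x∉ AllPairs.∷ _) {Fin.suc i} {Fin.zero} eq =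
    ⊥-elim (All.lookup x∉ (∈-lookup i) (sym eq))
  Unique⇒lookup-injective {_ ∷ _} (_ AllPairs.∷ u) {Fin.suc i} {Fin.suc j} eq =
    cong Fin.suc (Unique⇒lookup-injective u eq)

  length-≤-by-injection : {xs : List A} {ys : List B} (f : A → B) → Unique xs →
    (∀ {x} → x ∈ₗ xs → f x ∈ₗ ys) →
    (∀ {x y} → x ∈ₗ xs → y ∈ₗ xs → f x ≡ f y → x ≡ y) →
    length xs ≤ length ys
  length-≤-by-injection {xs} {ys} f unique into injective = Finₚ.injective⇒≤ position-injective
    where
    position : Fin (length xs) → Fin (length ys)
    position i = Any.index (into (∈-lookup i))

    position-injective : ∀ {i j} → position i ≡ position j → i ≡ j
    position-injective {i} {j} eq = Unique⇒lookup-injective unique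
      (injective (∈-lookup i) (∈-lookup j) (begin
        f (lookup xs i)                 ≡⟨ lookup-index (into (∈-lookup i)) ⟩
        lookup ys (position i)          ≡⟨ cong (lookup ys) eq ⟩
        lookup ys (position j)          ≡⟨ lookup-index (into (∈-lookup j)) ⟨
        f (lookup xs j)                 ∎))
      where open ≡-Reasoning

module _ {A B C : Set} where

  length-cartesianProductWith : (f : A → B → C) (xs : List A) (ys : List B) →
    length (cartesianProductWith f xs ys) ≡ length xs * length ys
  length-cartesianProductWith f [] ys = refl
  length-cartesianProductWith f (x ∷ xs) ys = begin
    length (map (f x) ys ++ cartesianProductWith f xs ys)          ≡⟨ length-++ (map (f x) ys) ⟩
    length (map (f x) ys) + length (cartesianProductWith f xs ys)  ≡⟨ cong₂ _+_ (length-map (f x) ys)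
                                                                        (length-cartesianProductWith f xs ys) ⟩
    length ys + length xs * length ys                              ∎
    where open ≡-Reasoning

elements : ∀ {n} → Subset n → List (Fin n)
elements []ᵥ = []
elements (inside ∷ᵥ p) = Fin.zero ∷ map Fin.suc (elements p)
elements (outside ∷ᵥ p) = map Fin.suc (elements p)

length-elements : ∀ {n} (p : Subset n) → length (elements p) ≡ ∣ p ∣
length-elements []ᵥ = refl
length-elements (inside ∷ᵥ p) = cong suc (trans (length-map Fin.suc (elements p)) (length-elements p))
length-elements (outside ∷ᵥ p) = trans (length-map Fin.suc (elements p)) (length-elements p)

∈-elements⁺ : ∀ {n} {p : Subset n} {x} → x ∈ p → x ∈ₗ elements p
∈-elements⁺ {p = inside ∷ᵥ p} Vec.here = Any.here refl
∈-elements⁺ {p = inside ∷ᵥ p} (Vec.there x∈p) = Any.there (∈-map⁺ Fin.suc (∈-elements⁺ x∈p))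
∈-elements⁺ {p = outside ∷ᵥ p} (Vec.there x∈p) = ∈-map⁺ Fin.suc (∈-elements⁺ x∈p)

∈-elements⁻ : ∀ {n} {p : Subset n} {x} → x ∈ₗ elements p → x ∈ p
∈-elements⁻ {p = inside ∷ᵥ p} (Any.here refl) = Vec.here
∈-elements⁻ {p = inside ∷ᵥ p} (Any.there h) with ∈-map⁻ Fin.suc h
... | _ , y∈ , refl = Vec.there (∈-elements⁻ y∈)
∈-elements⁻ {p = outside ∷ᵥ p} h with ∈-map⁻ Fin.suc h
... | _ , y∈ , refl = Vec.there (∈-elements⁻ y∈)

elements-unique : ∀ {n} (p : Subset n) → Unique (elements p)
elements-unique []ᵥ = AllPairs.[]
elements-unique (inside ∷ᵥ p) =
  All.tabulate (λ y∈ → zero≢suc (∈-map⁻ Fin.suc y∈)) AllPairs.∷ map⁺ Finₚ.suc-injective (elements-unique p)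
  where
  zero≢suc : ∀ {n} {y : Fin (suc n)} {ys} → ∃ (λ z → z ∈ₗ ys × y ≡ Fin.suc z) → Fin.zero ≢ y
  zero≢suc (_ , _ , refl) ()
elements-unique (outside ∷ᵥ p) = map⁺ Finₚ.suc-injective (elements-unique p)

∣p∣≡length : ∀ {n} {p : Subset n} {xs : List (Fin n)} → Unique xs →
  (∀ x → x ∈ p ⇔ x ∈ₗ xs) → ∣ p ∣ ≡ length xs
∣p∣≡length {p = p} unique members = trans (sym (length-elements p)) (≤-antisym
  (length-≤-by-injection id (elements-unique p) (λ h → Equivalence.to (members _) (∈-elements⁻ h)) (λ _ _ → id))
  (length-≤-by-injection id unique (λ h → ∈-elements⁺ (Equivalence.from (members _) h)) (λ _ _ → id)))

⊆∧∣∣≡suc⇒≡∪⁅⁆ : ∀ {n} {R G : Subset n} → R ⊆ G → ∣ G ∣ ≡ suc ∣ R ∣ → ∃ λ u → u ∉ R × G ≡ R ∪ ⁅ u ⁆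
⊆∧∣∣≡suc⇒≡∪⁅⁆ {R = R} {G} R⊆G ∣G∣≡1+∣R∣ with Finₚ.any? (λ x → x ∈? G ×-dec ¬? (x ∈? R))
... | no nothing-new = ⊥-elim (1+n≰n (subst (_≤ ∣ R ∣) ∣G∣≡1+∣R∣ (p⊆q⇒∣p∣≤∣q∣ G⊆R)))
  where
  G⊆R : G ⊆ R
  G⊆R {x} x∈G = decidable-stable (x ∈? R) (λ x∉R → nothing-new (x , x∈G , x∉R))
... | yes (u , u∈G , u∉R) = u , u∉R , ⊆-antisym G⊆R∪u R∪u⊆G
  where
  R∪u⊆G : R ∪ ⁅ u ⁆ ⊆ G
  R∪u⊆G x∈R∪u with x∈p∪q⁻ R ⁅ u ⁆ x∈R∪u
  ... | inj₁ x∈R = R⊆G x∈R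
  ... | inj₂ x∈⁅u⁆ = subst (_∈ G) (sym (x∈⁅y⁆⇒x≡y u x∈⁅u⁆)) u∈G

  R⊂R∪u : R ⊂ R ∪ ⁅ u ⁆
  R⊂R∪u = (λ x∈R → x∈p∪q⁺ (inj₁ x∈R)) , u , x∈p∪q⁺ (inj₂ (x∈⁅x⁆ u)) , u∉R

  -- A second new vertex would make R ⊂ R ∪ ⁅ u ⁆ ⊂ G, two strict steps within a gap of one.
  G⊆R∪u : G ⊆ R ∪ ⁅ u ⁆
  G⊆R∪u {x} x∈G = decidable-stable (x ∈? R ∪ ⁅ u ⁆) λ x∉R∪u →
    <-irrefl refl (<-≤-trans (p⊂q⇒∣p∣<∣q∣ R⊂R∪u)
      (≤-pred (subst (∣ R ∪ ⁅ u ⁆ ∣ <_) ∣G∣≡1+∣R∣ (p⊂q⇒∣p∣<∣q∣ (R∪u⊆G , x , x∈G , x∉R∪u)))))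

subsetOf : ∀ {n} {P : Fin n → Set} → (∀ x → Dec (P x)) → Subset n
subsetOf P? = Vec.tabulate (λ x → does (P? x))

∈-subsetOf : ∀ {n} {P : Fin n → Set} (P? : ∀ x → Dec (P x)) {x} → x ∈ subsetOf P? ⇔ P x
∈-subsetOf P? {x} = mk⇔ to (λ px → Vecₚ.lookup⇒[]= x _ (trans (Vecₚ.lookup∘tabulate _ x) (dec-true (P? x) px)))
  where
  to : x ∈ subsetOf P? → _
  to x∈ with P? x | trans (sym (Vecₚ.lookup∘tabulate (λ y → does (P? y)) x)) (Vecₚ.[]=⇒lookup x∈)
  ... | yes px | _ = px
  ... | no _ | ()

oneTo : ℕ → List ℕ
oneTo m = applyUpTo suc m

length-oneTo : ∀ m → length (oneTo m) ≡ m
length-oneTo = length-applyUpTo suc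

∈-oneTo⁺ : ∀ {m x} → 1 ≤ x → x ≤ m → x ∈ₗ oneTo m
∈-oneTo⁺ {x = suc x} _ x<m = ∈-applyUpTo⁺ suc x<m

∈-oneTo⁻ : ∀ {m x} → x ∈ₗ oneTo m → 1 ≤ x × x ≤ m
∈-oneTo⁻ x∈ with ∈-applyUpTo⁻ suc x∈
... | _ , x<m , refl = s≤s z≤n , x<m

oneTo-unique : ∀ m → Unique (oneTo m)
oneTo-unique m = applyUpTo⁺₁ suc m (λ i<j _ → <⇒≢ (s≤s i<j))

module _ {A : Set} where

  vectors : (k : ℕ) → List A → List (Vec A k)
  vectors zero xs = []ᵥ ∷ []
  vectors (suc k) xs = cartesianProductWith _∷ᵥ_ xs (vectors k xs)

  length-vectors : ∀ k (xs : List A) → length (vectors k xs) ≡ length xs ^ k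
  length-vectors zero xs = refl
  length-vectors (suc k) xs =
    trans (length-cartesianProductWith _∷ᵥ_ xs (vectors k xs)) (cong (length xs *_) (length-vectors k xs))

  ∈-vectors⁺ : ∀ {k} {xs : List A} {v : Vec A k} → (∀ j → Vec.lookup v j ∈ₗ xs) → v ∈ₗ vectors k xs
  ∈-vectors⁺ {v = []ᵥ} _ = Any.here refl
  ∈-vectors⁺ {v = x ∷ᵥ v} h = ∈-cartesianProductWith⁺ _∷ᵥ_ (h Fin.zero) (∈-vectors⁺ (λ j → h (Fin.suc j)))

  ∈-vectors⁻ : ∀ {k} {xs : List A} {v : Vec A k} → v ∈ₗ vectors k xs → ∀ j → Vec.lookup v j ∈ₗ xs
  ∈-vectors⁻ {suc k} {xs} v∈ j with ∈-cartesianProductWith⁻ _∷ᵥ_ xs (vectors k xs) v∈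
  ∈-vectors⁻ v∈ Fin.zero | _ , _ , x∈ , _ , refl = x∈
  ∈-vectors⁻ v∈ (Fin.suc j) | _ , _ , _ , w∈ , refl = ∈-vectors⁻ w∈ j

  vectors-unique : ∀ k {xs : List A} → Unique xs → Unique (vectors k xs)
  vectors-unique zero _ = All.[] AllPairs.∷ AllPairs.[]
  vectors-unique (suc k) u = cartesianProductWith⁺ _∷ᵥ_ Vecₚ.∷-injective u (vectors-unique k u)

lookup-extensional : ∀ {A : Set} {k} {v v′ : Vec A k} → (∀ j → Vec.lookup v j ≡ Vec.lookup v′ j) → v ≡ v′
lookup-extensional {v = v} {v′} eq =
  trans (sym (Vecₚ.tabulate∘lookup v)) (trans (Vecₚ.tabulate-cong eq) (Vecₚ.tabulate∘lookup v′))

-- Pairs and vertex labels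

pigeonhole-two : {A : Set} {c₁ c₂ x y z : A} →
  x ≡ c₁ ⊎ x ≡ c₂ → y ≡ c₁ ⊎ y ≡ c₂ → z ≡ c₁ ⊎ z ≡ c₂ → x ≡ y ⊎ x ≡ z ⊎ y ≡ z
pigeonhole-two (inj₁ refl) (inj₁ refl) _ = inj₁ refl
pigeonhole-two (inj₂ refl) (inj₂ refl) _ = inj₁ refl
pigeonhole-two (inj₁ refl) (inj₂ refl) (inj₁ refl) = inj₂ (inj₁ refl)
pigeonhole-two (inj₁ refl) (inj₂ refl) (inj₂ refl) = inj₂ (inj₂ refl)
pigeonhole-two (inj₂ refl) (inj₁ refl) (inj₁ refl) = inj₂ (inj₂ refl)
pigeonhole-two (inj₂ refl) (inj₁ refl) (inj₂ refl) = inj₂ (inj₁ refl)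

InPair : ℕ → ℕ → ℕ → Set
InPair c ℓ v = v ≡ c ⊎ v ≡ c + ℓ

InPair-shift : ∀ {c ℓ x d} → 1 ≤ d → InPair c ℓ x → InPair c ℓ (x + d) → x ≡ c × d ≡ ℓ
InPair-shift {c} 1≤d (inj₁ refl) (inj₁ eq) = ⊥-elim (<⇒≢ (m<m+n c 1≤d) (sym eq))
InPair-shift {c} 1≤d (inj₁ refl) (inj₂ eq) = refl , +-cancelˡ-≡ c _ _ eq
InPair-shift {c} {ℓ} {d = d} 1≤d (inj₂ refl) (inj₁ eq) =
  ⊥-elim (<⇒≢ (≤-trans (m<m+n c 1≤d) (+-monoˡ-≤ d (m≤m+n c ℓ))) (sym eq))
InPair-shift {c} {ℓ} 1≤d (inj₂ refl) (inj₂ eq) = ⊥-elim (<⇒≢ (m<m+n (c + ℓ) 1≤d) (sym eq))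

partner : ∀ {c ℓ v} → InPair c ℓ v → ℕ
partner {c} {ℓ} (inj₁ _) = c + ℓ
partner {c} (inj₂ _) = c

partner-InPair : ∀ {c ℓ v} (p : InPair c ℓ v) → InPair c ℓ (partner p)
partner-InPair (inj₁ _) = inj₂ refl
partner-InPair (inj₂ _) = inj₁ refl

partner-≢ : ∀ {c ℓ v} → 1 ≤ ℓ → (p : InPair c ℓ v) → partner p ≢ v
partner-≢ {c} 1≤ℓ (inj₁ refl) = ≢-sym (<⇒≢ (m<m+n c 1≤ℓ))
partner-≢ {c} 1≤ℓ (inj₂ refl) = <⇒≢ (m<m+n c 1≤ℓ)

partner-near : ∀ {c ℓ v} (p : InPair c ℓ v) → partner p ≡ v + ℓ ⊎ partner p ≡ v ∸ ℓ
partner-near (inj₁ refl) = inj₁ refl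
partner-near {c} {ℓ} (inj₂ refl) = inj₂ (sym (m+n∸n≡m c ℓ))

InPair-third : ∀ {c ℓ x y z} → InPair c ℓ x → InPair c ℓ y → InPair c ℓ z → x ≢ y → z ≢ y → x ≡ z
InPair-third x∈ y∈ z∈ x≢y z≢y with pigeonhole-two x∈ y∈ z∈
... | inj₁ x≡y = ⊥-elim (x≢y x≡y)
... | inj₂ (inj₁ x≡z) = x≡z
... | inj₂ (inj₂ y≡z) = ⊥-elim (z≢y (sym y≡z))

label : ∀ {n} → Fin n → ℕ
label x = suc (toℕ x)

label-injective : ∀ {n} {x y : Fin n} → label x ≡ label y → x ≡ y
label-injective eq = Finₚ.toℕ-injective (suc-injective eq)

vertex : ∀ {n} v → 1 ≤ v → v ≤ n → Fin n
vertex (suc v) _ v<n = fromℕ< v<n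

label-vertex : ∀ {n} v (1≤v : 1 ≤ v) (v≤n : v ≤ n) → label (vertex v 1≤v v≤n) ≡ v
label-vertex (suc v) _ v<n = cong suc (Finₚ.toℕ-fromℕ< v<n)

infix 4 _∈ˡ_
_∈ˡ_ : ∀ {n} → ℕ → Subset n → Set
v ∈ˡ F = ∃ λ x → label x ≡ v × x ∈ F

∈ˡ-∪⁺ˡ : ∀ {n v} {R : Subset n} (Q : Subset n) → v ∈ˡ R → v ∈ˡ R ∪ Q
∈ˡ-∪⁺ˡ _ (x , eq , x∈R) = x , eq , x∈p∪q⁺ (inj₁ x∈R)

∈ˡ-∪⁅⁆⁻ : ∀ {n v} {R : Subset n} {u} → v ∈ˡ R ∪ ⁅ u ⁆ → v ∈ˡ R ⊎ v ≡ label u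
∈ˡ-∪⁅⁆⁻ {R = R} {u} (x , refl , x∈) with x∈p∪q⁻ R ⁅ u ⁆ x∈
... | inj₁ x∈R = inj₁ (x , refl , x∈R)
... | inj₂ x∈⁅u⁆ = inj₂ (cong label (x∈⁅y⁆⇒x≡y u x∈⁅u⁆))

∈ˡ-∪⁅⁆-≢ : ∀ {n v} {R : Subset n} {u} → v ∈ˡ R ∪ ⁅ u ⁆ → v ≢ label u → v ∈ˡ R
∈ˡ-∪⁅⁆-≢ v∈ v≢u = Sum.[ id , (λ v≡u → ⊥-elim (v≢u v≡u)) ] (∈ˡ-∪⁅⁆⁻ v∈)

∈ˡ-∪⁅⁆-∉ : ∀ {n v} {R : Subset n} {u} → v ∈ˡ R ∪ ⁅ u ⁆ → ¬ (v ∈ˡ R) → v ≡ label u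
∈ˡ-∪⁅⁆-∉ v∈ v∉R = Sum.[ (λ v∈R → ⊥-elim (v∉R v∈R)) , id ] (∈ˡ-∪⁅⁆⁻ v∈)

another : ∀ {k} → 2 ≤ k → (j : Fin k) → ∃ λ j′ → j′ ≢ j
another (s≤s (s≤s _)) j = Fin.punchIn j Fin.zero , Finₚ.punchInᵢ≢i j Fin.zero

2k≡1+[2k∸1] : ∀ {k} → 1 ≤ k → 2 * k ≡ suc (2 * k ∸ 1)
2k≡1+[2k∸1] (s≤s _) = refl

window : ∀ {k a β} → 1 ≤ k → k ≤ a → 1 ≤ β → β ≤ a → ∃ λ c → c + k ≤ a × c < β × β ≤ c + k
window {k} {a} {β} 1≤k k≤a 1≤β β≤a with ≤-total β k
... | inj₁ β≤k = 0 , k≤a , 1≤β , β≤k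
... | inj₂ k≤β =
  β ∸ k , ≤-trans (≤-reflexive c+k≡β) β≤a , subst (β ∸ k <_) c+k≡β (m<m+n (β ∸ k) 1≤k) , ≤-reflexive (sym c+k≡β)
  where
  c+k≡β : β ∸ k + k ≡ β
  c+k≡β = m∸n+n≡m k≤β

q<q′⇒q*m+r<q′*m+r′ : ∀ {m q q′ r} r′ → q < q′ → r < m → q * m + r < q′ * m + r′
q<q′⇒q*m+r<q′*m+r′ {m} {q} {q′} {r} r′ q<q′ r<m = begin-strict
  q * m + r      <⟨ +-monoʳ-< (q * m) r<m ⟩
  q * m + m      ≡⟨ +-comm (q * m) m ⟩
  suc q * m      ≤⟨ *-monoˡ-≤ m q<q′ ⟩
  q′ * m         ≤⟨ m≤m+n (q′ * m) r′ ⟩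
  q′ * m + r′    ∎
  where open ≤-Reasoning

quotient-remainder-unique : ∀ {m q q′ r r′} → r < m → r′ < m → q * m + r ≡ q′ * m + r′ → q ≡ q′ × r ≡ r′
quotient-remainder-unique {m} {q} {q′} {r} {r′} r<m r′<m eq with <-cmp q q′
... | tri< q<q′ _ _ = ⊥-elim (<⇒≢ (q<q′⇒q*m+r<q′*m+r′ r′ q<q′ r<m) eq)
... | tri≈ _ refl _ = refl , +-cancelˡ-≡ (q * m) r r′ eq
... | tri> _ _ q′<q = ⊥-elim (<⇒≢ (q<q′⇒q*m+r<q′*m+r′ r q′<q r′<m) (sym eq))

-- The complex of an interval partition

module Complex (k n a s : ℕ) (e : ℕ → ℕ)
  (e-step : ∀ b → b < a → e b ≤ e (suc b)) (e[a]≡n : e a ≡ n) where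

  e-mono : ∀ {b b′} → b ≤ b′ → b′ ≤ a → e b ≤ e b′
  e-mono {b′ = zero} z≤n _ = ≤-refl
  e-mono {b} {suc b′} b≤1+b′ 1+b′≤a with m≤n⇒m<n∨m≡n b≤1+b′
  ... | inj₁ b<1+b′ = ≤-trans (e-mono (≤-pred b<1+b′) (<⇒≤ 1+b′≤a)) (e-step b′ 1+b′≤a)
  ... | inj₂ refl = ≤-refl

  e≤n : ∀ {b} → b ≤ a → e b ≤ n
  e≤n b≤a = subst (_ ≤_) e[a]≡n (e-mono b≤a ≤-refl)

  InBlock-ordered : ∀ {β β′ x y} → β < β′ → β′ ≤ a → InBlock e β x → InBlock e β′ y → x < y
  InBlock-ordered β<β′ β′≤a (_ , x≤eβ) (e[β′-1]<y , _) =
    ≤-<-trans x≤eβ (≤-<-trans (e-mono (<⇒≤pred β<β′) (≤-trans pred[n]≤n β′≤a)) e[β′-1]<y)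

  InBlock-unique : ∀ {β β′ x} → β ≤ a → β′ ≤ a → InBlock e β x → InBlock e β′ x → β ≡ β′
  InBlock-unique {β} {β′} β≤a β′≤a x∈β x∈β′ with <-cmp β β′
  ... | tri< β<β′ _ _ = ⊥-elim (<-irrefl refl (InBlock-ordered β<β′ β′≤a x∈β x∈β′))
  ... | tri≈ _ β≡β′ _ = β≡β′
  ... | tri> _ _ β′<β = ⊥-elim (<-irrefl refl (InBlock-ordered β′<β β≤a x∈β′ x∈β))

  Increasing : (Fin k → ℕ) → Set
  Increasing b = ∀ j j′ → j Fin.< j′ → b j < b j′

  InBlocks : ℕ → (Fin k → ℕ) → (Fin k → ℕ) → Set
  InBlocks ℓ i b = ∀ j → 1 ≤ b j × b j ≤ a × InBlock e (b j) (i j) × InBlock e (b j) (i j + ℓ)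

  IsShape : ℕ → (Fin k → ℕ) → (Fin k → ℕ) → Set
  IsShape ℓ i b = 1 ≤ ℓ × ℓ ≤ s × Increasing b × InBlocks ℓ i b

  Describes : ℕ → (Fin k → ℕ) → Subset n → Set
  Describes ℓ i F = ∀ x → x ∈ F ⇔ ∃ λ j → InPair (i j) ℓ (label x)

  Facet : Subset n → Set
  Facet = IsFacet k n a s e

  module Shape {ℓ : ℕ} {i b : Fin k → ℕ} (σ : IsShape ℓ i b) where

    1≤ℓ : 1 ≤ ℓ
    1≤ℓ = proj₁ σ

    in-blocks : InBlocks ℓ i b
    in-blocks = proj₂ (proj₂ (proj₂ σ))

    b≤a : ∀ j → b j ≤ a
    b≤a j = proj₁ (proj₂ (in-blocks j))

    b-injective : ∀ {j j′} → b j ≡ b j′ → j ≡ j′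
    b-injective {j} {j′} eq with Finₚ.<-cmp j j′
    ... | tri< j<j′ _ _ = ⊥-elim (<⇒≢ (proj₁ (proj₂ (proj₂ σ)) j j′ j<j′) eq)
    ... | tri≈ _ j≡j′ _ = j≡j′
    ... | tri> _ _ j′<j = ⊥-elim (<⇒≢ (proj₁ (proj₂ (proj₂ σ)) j′ j j′<j) (sym eq))

    Pair : Fin k → ℕ → Set
    Pair j = InPair (i j) ℓ

    Pair⇒InBlock : ∀ {j v} → Pair j v → InBlock e (b j) v
    Pair⇒InBlock {j} (inj₁ refl) = proj₁ (proj₂ (proj₂ (in-blocks j)))
    Pair⇒InBlock {j} (inj₂ refl) = proj₂ (proj₂ (proj₂ (in-blocks j)))

    Pair-unique : ∀ {j j′ v} → Pair j v → Pair j′ v → j ≡ j′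
    Pair-unique p p′ = b-injective (InBlock-unique (b≤a _) (b≤a _) (Pair⇒InBlock p) (Pair⇒InBlock p′))

    Pair⇒1≤ : ∀ {j v} → Pair j v → 1 ≤ v
    Pair⇒1≤ p = ≤-trans (s≤s z≤n) (proj₁ (Pair⇒InBlock p))

    Pair⇒≤n : ∀ {j v} → Pair j v → v ≤ n
    Pair⇒≤n {j} p = ≤-trans (proj₂ (Pair⇒InBlock p)) (e≤n (b≤a j))

    pairVertex : ∀ {j v} → Pair j v → Fin n
    pairVertex p = vertex _ (Pair⇒1≤ p) (Pair⇒≤n p)

    label-pairVertex : ∀ {j v} (p : Pair j v) → label (pairVertex p) ≡ v
    label-pairVertex p = label-vertex _ _ _

    module _ {F : Subset n} (desc : Describes ℓ i F) where

      Pair⇒∈ˡ : ∀ {j v} → Pair j v → v ∈ˡ F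
      Pair⇒∈ˡ {j} p = pairVertex p , label-pairVertex p ,
        Equivalence.from (desc _) (j , subst (Pair j) (sym (label-pairVertex p)) p)

      ∈ˡ⇒Pair : ∀ {v} → v ∈ˡ F → ∃ λ j → Pair j v
      ∈ˡ⇒Pair (x , refl , x∈F) = Equivalence.to (desc x) x∈F

      ∈ˡ∧InBlock⇒Pair : ∀ {j v} → v ∈ˡ F → InBlock e (b j) v → Pair j v
      ∈ˡ∧InBlock⇒Pair {j} {v} v∈F v∈bj with ∈ˡ⇒Pair v∈F
      ... | j′ , p = subst (λ m → Pair m v) (b-injective (InBlock-unique (b≤a j′) (b≤a j) (Pair⇒InBlock p) v∈bj)) p

      pair-recognised : ∀ {c d β} → 1 ≤ d → c ∈ˡ F → c + d ∈ˡ F →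
        β ≤ a → InBlock e β c → InBlock e β (c + d) → ∃ λ j → b j ≡ β × c ≡ i j × d ≡ ℓ
      pair-recognised {c} {d} 1≤d c∈F c+d∈F β≤a c∈β c+d∈β with ∈ˡ⇒Pair c∈F
      ... | j , p =
        j , bj≡β , InPair-shift 1≤d p (∈ˡ∧InBlock⇒Pair c+d∈F (subst (λ β → InBlock e β (c + d)) (sym bj≡β) c+d∈β))
        where
        bj≡β : b j ≡ _
        bj≡β = InBlock-unique (b≤a j) β≤a (Pair⇒InBlock p) c∈β

      ∣F∣≡2k : ∣ F ∣ ≡ 2 * k
      ∣F∣≡2k = begin
        ∣ F ∣                                          ≡⟨ ∣p∣≡length unique members ⟩
        length (tabulate lower ++ tabulate upper)      ≡⟨ length-++ (tabulate lower) ⟩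
        length (tabulate lower) + length (tabulate upper) ≡⟨ cong₂ _+_ (length-tabulate lower) (length-tabulate upper) ⟩
        k + k                                          ≡⟨ cong (k +_) (+-identityʳ k) ⟨
        2 * k                                          ∎
        where
        open ≡-Reasoning
        lower upper : Fin k → Fin n
        lower j = pairVertex {j} (inj₁ refl)
        upper j = pairVertex {j} (inj₂ refl)

        label-lower : ∀ j → label (lower j) ≡ i j
        label-lower j = label-pairVertex {j} (inj₁ refl)

        label-upper : ∀ j → label (upper j) ≡ i j + ℓ
        label-upper j = label-pairVertex {j} (inj₂ refl)

        members : ∀ x → x ∈ F ⇔ x ∈ₗ tabulate lower ++ tabulate upper
        members x = mk⇔ to from
          where
          to : x ∈ F → x ∈ₗ tabulate lower ++ tabulate upper
          to x∈F with Equivalence.to (desc x) x∈F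
          ... | j , inj₁ eq = ∈-++⁺ˡ
            (subst (_∈ₗ tabulate lower) (label-injective (trans (label-lower j) (sym eq))) (∈-tabulate⁺ j))
          ... | j , inj₂ eq = ∈-++⁺ʳ (tabulate lower)
            (subst (_∈ₗ tabulate upper) (label-injective (trans (label-upper j) (sym eq))) (∈-tabulate⁺ j))

          from : x ∈ₗ tabulate lower ++ tabulate upper → x ∈ F
          from x∈ with ∈-++⁻ (tabulate lower) x∈
          ... | inj₁ x∈lower with ∈-tabulate⁻ x∈lower
          ...   | j , refl = Equivalence.from (desc x) (j , inj₁ (label-lower j))
          from x∈ | inj₂ x∈upper with ∈-tabulate⁻ x∈upper
          ...   | j , refl = Equivalence.from (desc x) (j , inj₂ (label-upper j))

        unique : Unique (tabulate lower ++ tabulate upper)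
        unique = ++⁺ (tabulate⁺ lower-injective) (tabulate⁺ upper-injective) disjoint
          where
          lower-injective : ∀ {j j′} → lower j ≡ lower j′ → j ≡ j′
          lower-injective {j} {j′} eq =
            Pair-unique (inj₁ refl) (inj₁ (trans (sym (label-lower j)) (trans (cong label eq) (label-lower j′))))

          upper-injective : ∀ {j j′} → upper j ≡ upper j′ → j ≡ j′
          upper-injective {j} {j′} eq =
            Pair-unique (inj₂ refl) (inj₂ (trans (sym (label-upper j)) (trans (cong label eq) (label-upper j′))))

          disjoint : ∀ {x} → ¬ (x ∈ₗ tabulate lower × x ∈ₗ tabulate upper)
          disjoint (x∈lower , x∈upper) with ∈-tabulate⁻ x∈lower | ∈-tabulate⁻ x∈upper
          ... | j , refl | j′ , eq =
            <⇒≢ (m<m+n (i j′) 1≤ℓ) (subst (λ m → i m ≡ i j′ + ℓ) (Pair-unique (inj₁ refl) (inj₂ ij≡ij′+ℓ)) ij≡ij′+ℓ)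
            where
            ij≡ij′+ℓ : i j ≡ i j′ + ℓ
            ij≡ij′+ℓ = trans (sym (label-lower j)) (trans (cong label eq) (label-upper j′))

  -- F₁ = R ∪ ⁅ u₁ ⁆ is a facet and p̂ the partner of u₁ in it; the extra vertex u of any facet
  -- G = R ∪ ⁅ u ⁆ turns out to be the partner q̂ of p̂ in G.
  module ExtraVertex (2≤k : 2 ≤ k) {R : Subset n} {u₁ : Fin n} (u₁∉R : u₁ ∉ R)
    {ℓ : ℕ} {i b : Fin k → ℕ} (σ : IsShape ℓ i b) (desc : Describes ℓ i (R ∪ ⁅ u₁ ⁆)) where
    open Shape σ

    u₁-pair : ∃ λ j → Pair j (label u₁)
    u₁-pair = ∈ˡ⇒Pair desc (u₁ , refl , x∈p∪q⁺ (inj₂ (x∈⁅x⁆ u₁)))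

    j₁ : Fin k
    j₁ = proj₁ u₁-pair

    p̂ : ℕ
    p̂ = partner (proj₂ u₁-pair)

    p̂∈R : p̂ ∈ˡ R
    p̂∈R = ∈ˡ-∪⁅⁆-≢ (Pair⇒∈ˡ desc (partner-InPair (proj₂ u₁-pair))) (partner-≢ 1≤ℓ (proj₂ u₁-pair))

    j₂ : Fin k
    j₂ = proj₁ (another 2≤k j₁)

    j₂-pair⊆R : ∀ {v} → Pair j₂ v → v ∈ˡ R
    j₂-pair⊆R p = ∈ˡ-∪⁅⁆-≢ (Pair⇒∈ˡ desc p) λ { refl → proj₂ (another 2≤k j₁) (Pair-unique p (proj₂ u₁-pair)) }

    module _ {u : Fin n} {ℓ′ : ℕ} {i′ b′ : Fin k → ℕ}
             (σ′ : IsShape ℓ′ i′ b′) (desc′ : Describes ℓ′ i′ (R ∪ ⁅ u ⁆)) where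
      private module G = Shape σ′

      -- The pair j₂ of F₁ lies in R, so it is a pair of G too, which pins down ℓ′.
      ℓ′≡ℓ : ℓ′ ≡ ℓ
      ℓ′≡ℓ = sym (proj₂ (proj₂ (proj₂ (G.pair-recognised desc′ {c = i j₂} {β = b j₂} 1≤ℓ
        (∈ˡ-∪⁺ˡ ⁅ u ⁆ (j₂-pair⊆R (inj₁ refl))) (∈ˡ-∪⁺ˡ ⁅ u ⁆ (j₂-pair⊆R (inj₂ refl)))
        (b≤a j₂) (Pair⇒InBlock (inj₁ refl)) (Pair⇒InBlock (inj₂ refl))))))

      p̂-G-pair : ∃ λ m → G.Pair m p̂
      p̂-G-pair = G.∈ˡ⇒Pair desc′ (∈ˡ-∪⁺ˡ ⁅ u ⁆ p̂∈R)

      q̂ : ℕ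
      q̂ = partner (proj₂ p̂-G-pair)

      same-block : b′ (proj₁ p̂-G-pair) ≡ b j₁
      same-block = InBlock-unique (G.b≤a _) (b≤a j₁)
        (G.Pair⇒InBlock (proj₂ p̂-G-pair)) (Pair⇒InBlock (partner-InPair (proj₂ u₁-pair)))

      -- In F₁ the block of p̂ holds only p̂ and u₁, and u₁ ∉ R.
      q̂∉R : ¬ (q̂ ∈ˡ R)
      q̂∉R q̂∈R@(x , x≡q̂ , x∈R) = u₁∉R (subst (_∈ R) (label-injective (trans x≡q̂ q̂≡u₁)) x∈R)
        where
        q̂-F₁-pair : Pair j₁ q̂
        q̂-F₁-pair = ∈ˡ∧InBlock⇒Pair desc (∈ˡ-∪⁺ˡ ⁅ u₁ ⁆ q̂∈R)
          (subst (λ β → InBlock e β q̂) same-block (G.Pair⇒InBlock (partner-InPair (proj₂ p̂-G-pair))))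

        q̂≡u₁ : q̂ ≡ label u₁
        q̂≡u₁ = InPair-third q̂-F₁-pair (partner-InPair (proj₂ u₁-pair)) (proj₂ u₁-pair)
          (partner-≢ G.1≤ℓ (proj₂ p̂-G-pair)) (≢-sym (partner-≢ 1≤ℓ (proj₂ u₁-pair)))

      extra-near : label u ≡ p̂ + ℓ ⊎ label u ≡ p̂ ∸ ℓ
      extra-near = Sum.map (λ eq → trans (sym q̂≡u) (trans eq (cong (p̂ +_) ℓ′≡ℓ)))
                           (λ eq → trans (sym q̂≡u) (trans eq (cong (p̂ ∸_) ℓ′≡ℓ)))
                           (partner-near (proj₂ p̂-G-pair))
        where
        q̂≡u : q̂ ≡ label u
        q̂≡u = ∈ˡ-∪⁅⁆-∉ (G.Pair⇒∈ˡ desc′ (partner-InPair (proj₂ p̂-G-pair))) q̂∉R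

  extra-vertices-two-valued : 2 ≤ k → ∀ {R u₁} → u₁ ∉ R → Facet (R ∪ ⁅ u₁ ⁆) →
    ∃₂ λ c₁ c₂ → ∀ {u} → Facet (R ∪ ⁅ u ⁆) → label u ≡ c₁ ⊎ label u ≡ c₂
  extra-vertices-two-valued 2≤k u₁∉R (ℓ , 1≤ℓ , ℓ≤s , _ , _ , inc , blocks , desc) =
    p̂ + ℓ , p̂ ∸ ℓ ,
    λ { (_ , 1≤ℓ′ , ℓ′≤s , _ , _ , inc′ , blocks′ , desc′) → extra-near (1≤ℓ′ , ℓ′≤s , inc′ , blocks′) desc′ }
    where open ExtraVertex 2≤k u₁∉R (1≤ℓ , ℓ≤s , inc , blocks) desc

  facet-size : 1 ≤ k → ∀ {F} → Facet F → ∣ F ∣ ≡ suc (2 * k ∸ 1)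
  facet-size 1≤k (_ , 1≤ℓ , ℓ≤s , _ , _ , inc , blocks , desc) =
    trans (Shape.∣F∣≡2k (1≤ℓ , ℓ≤s , inc , blocks) desc) (2k≡1+[2k∸1] 1≤k)

  facet⊇ridge⇒≡∪⁅⁆ : 2 ≤ k → ∀ {R F} → ∣ R ∣ ≡ 2 * k ∸ 1 → R ⊆ F → Facet F → ∃ λ u → u ∉ R × F ≡ R ∪ ⁅ u ⁆
  facet⊇ridge⇒≡∪⁅⁆ 2≤k ∣R∣≡ R⊆F f =
    ⊆∧∣∣≡suc⇒≡∪⁅⁆ R⊆F (trans (facet-size (≤-trans (s≤s z≤n) 2≤k) f) (cong suc (sym ∣R∣≡)))

  ridges-in-at-most-two-facets : 2 ≤ k → ∀ R → ∣ R ∣ ≡ 2 * k ∸ 1 → ∀ F₁ F₂ F₃ → Facet F₁ → Facet F₂ → Facet F₃ →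
    R ⊆ F₁ → R ⊆ F₂ → R ⊆ F₃ → (F₁ ≡ F₂) ⊎ (F₁ ≡ F₃) ⊎ (F₂ ≡ F₃)
  ridges-in-at-most-two-facets 2≤k R ∣R∣≡ F₁ F₂ F₃ f₁ f₂ f₃ R⊆F₁ R⊆F₂ R⊆F₃
    with facet⊇ridge⇒≡∪⁅⁆ 2≤k ∣R∣≡ R⊆F₁ f₁ | facet⊇ridge⇒≡∪⁅⁆ 2≤k ∣R∣≡ R⊆F₂ f₂ | facet⊇ridge⇒≡∪⁅⁆ 2≤k ∣R∣≡ R⊆F₃ f₃
  ... | u₁ , u₁∉R , refl | _ , _ , refl | _ , _ , refl with extra-vertices-two-valued 2≤k u₁∉R f₁
  ... | _ , _ , near =
    Sum.map same-extra (Sum.map same-extra same-extra) (pigeonhole-two (near f₁) (near f₂) (near f₃))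
    where
    same-extra : ∀ {u u′} → label u ≡ label u′ → R ∪ ⁅ u ⁆ ≡ R ∪ ⁅ u′ ⁆
    same-extra eq = cong (λ x → R ∪ ⁅ x ⁆) (label-injective eq)

  inPairs? : ∀ ℓ (i : Fin k → ℕ) (x : Fin n) → Dec (∃ λ j → InPair (i j) ℓ (label x))
  inPairs? ℓ i x = Finₚ.any? λ j → (label x ≟ i j) ⊎-dec (label x ≟ i j + ℓ)

  facet : ℕ → (Fin k → ℕ) → Subset n
  facet ℓ i = subsetOf (inPairs? ℓ i)

  facet-describes : ∀ ℓ (i : Fin k → ℕ) → Describes ℓ i (facet ℓ i)
  facet-describes ℓ i x = ∈-subsetOf (inPairs? ℓ i)

  Describes-cong : ∀ {ℓ i i′ F} → (∀ j → i j ≡ i′ j) → Describes ℓ i F → Describes ℓ i′ F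
  Describes-cong {ℓ} i≗i′ desc x = mk⇔
    (λ x∈F → map₂ (λ {j} → subst (λ c → InPair c ℓ (label x)) (i≗i′ j)) (Equivalence.to (desc x) x∈F))
    (λ pair → Equivalence.from (desc x) (map₂ (λ {j} → subst (λ c → InPair c ℓ (label x)) (sym (i≗i′ j))) pair))

  Describes⇒≡facet : ∀ {ℓ i F} → Describes ℓ i F → F ≡ facet ℓ i
  Describes⇒≡facet {ℓ} {i} desc = ⊆-antisym
    (λ {x} x∈F → Equivalence.from (facet-describes ℓ i x) (Equivalence.to (desc x) x∈F))
    (λ {x} x∈facet → Equivalence.from (desc x) (Equivalence.to (facet-describes ℓ i x) x∈facet))

  IsShape⇒Facet : ∀ {ℓ i b} → IsShape ℓ i b → Facet (facet ℓ i)
  IsShape⇒Facet {ℓ} {i} {b} (1≤ℓ , ℓ≤s , increasing , blocks) =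
    ℓ , 1≤ℓ , ℓ≤s , i , b , increasing , blocks , facet-describes ℓ i

  IsShape-cong : ∀ {ℓ i i′ b b′} → (∀ j → i j ≡ i′ j) → (∀ j → b j ≡ b′ j) → IsShape ℓ i b → IsShape ℓ i′ b′
  IsShape-cong {ℓ} {i′ = i′} {b′ = b′} i≗i′ b≗b′ (1≤ℓ , ℓ≤s , increasing , blocks) =
    1≤ℓ , ℓ≤s , (λ j j′ j<j′ → subst₂ _<_ (b≗b′ j) (b≗b′ j′) (increasing j j′ j<j′)) , blocks′
    where
    blocks′ : InBlocks ℓ i′ b′
    blocks′ j rewrite sym (i≗i′ j) | sym (b≗b′ j) = blocks j

  isShape? : ∀ ℓ i b → Dec (IsShape ℓ i b)
  isShape? ℓ i b = (1 ≤? ℓ) ×-dec (ℓ ≤? s) ×-dec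
    Finₚ.all? (λ j → Finₚ.all? λ j′ → (j Finₚ.<? j′) →-dec (b j <? b j′)) ×-dec
    Finₚ.all? λ j → (1 ≤? b j) ×-dec (b j ≤? a) ×-dec
      ((e (pred (b j)) <? i j) ×-dec (i j ≤? e (b j))) ×-dec
      ((e (pred (b j)) <? i j + ℓ) ×-dec (i j + ℓ ≤? e (b j)))

  candidates : List (ℕ × Vec ℕ k)
  candidates = cartesianProduct (oneTo s) (vectors k (oneTo n))

  Admissible : ℕ × Vec ℕ k → Set
  Admissible (ℓ , iv) = Any (λ bv → IsShape ℓ (Vec.lookup iv) (Vec.lookup bv)) (vectors k (oneTo a))

  admissible? : ∀ c → Dec (Admissible c)
  admissible? (ℓ , iv) = Any.any? (λ bv → isShape? ℓ (Vec.lookup iv) (Vec.lookup bv)) _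

  candidateFacet : ℕ × Vec ℕ k → Subset n
  candidateFacet (ℓ , iv) = facet ℓ (Vec.lookup iv)

  _≟ₛ_ : (F G : Subset n) → Dec (F ≡ G)
  _≟ₛ_ = Vecₚ.≡-dec Bool._≟_

  admitted : List (ℕ × Vec ℕ k)
  admitted = filter admissible? candidates

  facets : List (Subset n)
  facets = deduplicate _≟ₛ_ (map candidateFacet admitted)

  ∈-facets⁻ : ∀ {F} → F ∈ₗ facets → Facet F
  ∈-facets⁻ F∈ with ∈-map⁻ candidateFacet (∈-deduplicate⁻ _≟ₛ_ (map candidateFacet admitted) F∈)
  ... | c , c∈ , refl = IsShape⇒Facet (proj₂ (Any.satisfied (proj₂ (∈-filter⁻ admissible? {xs = candidates} c∈))))

  ∈-facets⁺ : ∀ {F} → Facet F → F ∈ₗ facets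
  ∈-facets⁺ (ℓ , 1≤ℓ , ℓ≤s , i , b , increasing , blocks , desc) =
    subst (_∈ₗ facets) (sym (Describes⇒≡facet (Describes-cong i≗ desc)))
      (∈-deduplicate⁺ _≟ₛ_ (∈-map⁺ candidateFacet (∈-filter⁺ admissible? candidate admissible)))
    where
    σ : IsShape ℓ i b
    σ = 1≤ℓ , ℓ≤s , increasing , blocks
    open Shape σ using (b≤a; Pair⇒1≤; Pair⇒≤n)

    i≗ : ∀ j → i j ≡ Vec.lookup (Vec.tabulate i) j
    i≗ j = sym (Vecₚ.lookup∘tabulate i j)

    b≗ : ∀ j → b j ≡ Vec.lookup (Vec.tabulate b) j
    b≗ j = sym (Vecₚ.lookup∘tabulate b j)

    candidate : (ℓ , Vec.tabulate i) ∈ₗ candidates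
    candidate = ∈-cartesianProduct⁺ (∈-oneTo⁺ 1≤ℓ ℓ≤s) (∈-vectors⁺ λ j →
      subst (_∈ₗ oneTo n) (i≗ j) (∈-oneTo⁺ (Pair⇒1≤ {j} (inj₁ refl)) (Pair⇒≤n {j} (inj₁ refl))))

    admissible : Admissible (ℓ , Vec.tabulate i)
    admissible = lose
      (∈-vectors⁺ {v = Vec.tabulate b} λ j → subst (_∈ₗ oneTo a) (b≗ j) (∈-oneTo⁺ (proj₁ (blocks j)) (b≤a j)))
      (IsShape-cong i≗ b≗ σ)

  facets-enumerate : EnumeratesFacets Facet facets
  facets-enumerate = deduplicate-! _≟ₛ_ _ , λ F → mk⇔ ∈-facets⁻ ∈-facets⁺

  length-facets≤ : length facets ≤ s * n ^ k
  length-facets≤ = begin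
    length facets                                    ≤⟨ length-deduplicate _≟ₛ_ (map candidateFacet admitted) ⟩
    length (map candidateFacet admitted)             ≡⟨ length-map candidateFacet admitted ⟩
    length admitted                                  ≤⟨ length-filter admissible? candidates ⟩
    length candidates                                ≡⟨ length-cartesianProductWith _,_ (oneTo s) (vectors k (oneTo n)) ⟩
    length (oneTo s) * length (vectors k (oneTo n))  ≡⟨ cong₂ _*_ (length-oneTo s) (length-vectors k (oneTo n)) ⟩
    s * length (oneTo n) ^ k                         ≡⟨ cong (λ l → s * l ^ k) (length-oneTo n) ⟩
    s * n ^ k                                        ∎
    where open ≤-Reasoning

  module Covering (1≤k : 1 ≤ k) (k≤a : k ≤ a) (1≤s : 1 ≤ s) (e[0]≡0 : e 0 ≡ 0)
    (long : ∀ b → b < a → 2 + e b ≤ e (suc b)) where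

    block-containing : ∀ {a′ v} → a′ ≤ a → e 0 < v → v ≤ e a′ → ∃ λ β → 1 ≤ β × β ≤ a′ × InBlock e β v
    block-containing {zero} _ e0<v v≤e0 = ⊥-elim (<-irrefl refl (<-≤-trans e0<v v≤e0))
    block-containing {suc a′} {v} 1+a′≤a e0<v v≤e[1+a′] with v ≤? e a′
    ... | yes v≤ea′ with block-containing (<⇒≤ 1+a′≤a) e0<v v≤ea′
    ...   | β , 1≤β , β≤a′ , v∈β = β , 1≤β , m≤n⇒m≤1+n β≤a′ , v∈β
    block-containing {suc a′} {v} 1+a′≤a e0<v v≤e[1+a′] | no v≰ea′ = suc a′ , s≤s z≤n , ≤-refl , ≰⇒> v≰ea′ , v≤e[1+a′]

    pair-around : ∀ {β v} → 1 ≤ β → β ≤ a → InBlock e β v →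
      ∃ λ p → InBlock e β p × InBlock e β (p + 1) × InPair p 1 v
    pair-around {suc β} {suc w} _ 1+β≤a (eβ<v , v≤e[1+β]) with suc w <? e (suc β)
    ... | yes v<e[1+β] =
      suc w , (eβ<v , v≤e[1+β]) ,
      (≤-trans eβ<v (m≤m+n (suc w) 1) , ≤-trans (≤-reflexive (+-comm (suc w) 1)) v<e[1+β]) , inj₁ refl
    ... | no v≮e[1+β] =
      w , (≤-pred (≤-trans (long β 1+β≤a) (≤-reflexive e[1+β]≡v)) , ≤-trans (n≤1+n w) v≤e[1+β]) ,
      (subst (e β <_) v≡w+1 eβ<v , subst (_≤ e (suc β)) v≡w+1 v≤e[1+β]) , inj₂ v≡w+1
      where
      e[1+β]≡v : e (suc β) ≡ suc w
      e[1+β]≡v = ≤-antisym (≮⇒≥ v≮e[1+β]) v≤e[1+β]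
      v≡w+1 : suc w ≡ w + 1
      v≡w+1 = sym (+-comm w 1)

    lowest-pair : ∀ b → b < a → InBlock e (suc b) (suc (e b)) × InBlock e (suc b) (suc (e b) + 1)
    lowest-pair b b<a =
      (≤-refl , ≤-trans (n≤1+n _) (long b b<a)) ,
      (m≤m+n (suc (e b)) 1 , ≤-trans (≤-reflexive (+-comm (suc (e b)) 1)) (long b b<a))

    -- The facet through p uses the k consecutive blocks c+1, …, c+k around β: with shift 1,
    -- the pair (p, p+1) in block β and the lowest pair in every other block.
    module Through {c β p : ℕ} (c+k≤a : c + k ≤ a) (c<β : c < β) (β≤c+k : β ≤ c + k)
      (p∈β : InBlock e β p) (p+1∈β : InBlock e β (p + 1)) where

      b : Fin k → ℕ
      b j = suc (c + toℕ j)

      t<k : β ∸ suc c < k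
      t<k = +-cancelˡ-≤ c _ _ (begin
        c + suc (β ∸ suc c)  ≡⟨ +-suc c (β ∸ suc c) ⟩
        suc c + (β ∸ suc c)  ≡⟨ m+[n∸m]≡n c<β ⟩
        β                    ≤⟨ β≤c+k ⟩
        c + k                ∎)
        where open ≤-Reasoning

      j₀ : Fin k
      j₀ = fromℕ< t<k

      b[j₀]≡β : b j₀ ≡ β
      b[j₀]≡β = trans (cong (λ t → suc (c + t)) (Finₚ.toℕ-fromℕ< t<k)) (m+[n∸m]≡n c<β)

      lowest : Fin k → ℕ
      lowest j = suc (e (c + toℕ j))

      i : Fin k → ℕ
      i = updateAt lowest j₀ (λ _ → p)

      c+j<a : ∀ j → c + toℕ j < a
      c+j<a j = <-≤-trans (+-monoʳ-< c (Finₚ.toℕ<n j)) c+k≤a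

      in-blocks : InBlocks 1 i b
      in-blocks j with j Finₚ.≟ j₀
      ... | yes refl rewrite updateAt-updates j₀ {λ _ → p} lowest =
        subst (λ β′ → 1 ≤ β′ × β′ ≤ a × InBlock e β′ p × InBlock e β′ (p + 1)) (sym b[j₀]≡β)
          (≤-trans (s≤s z≤n) c<β , ≤-trans β≤c+k c+k≤a , p∈β , p+1∈β)
      ... | no j≢j₀ rewrite updateAt-minimal j j₀ {λ _ → p} lowest j≢j₀ =
        s≤s z≤n , c+j<a j , lowest-pair (c + toℕ j) (c+j<a j)

      shape : IsShape 1 i b
      shape = ≤-refl , 1≤s , (λ j j′ j<j′ → s≤s (+-monoʳ-< c j<j′)) , in-blocks

      covers : ∀ {x} → InPair p 1 (label x) → x ∈ facet 1 i
      covers pair = Equivalence.from (facet-describes 1 i _)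
        (j₀ , subst (λ c → InPair c 1 _) (sym (updateAt-updates j₀ lowest)) pair)

    every-vertex-in-a-facet : ∀ x → ∃ λ F → Facet F × x ∈ F
    every-vertex-in-a-facet x
      with block-containing ≤-refl (subst (_< label x) (sym e[0]≡0) (s≤s z≤n))
                                   (subst (label x ≤_) (sym e[a]≡n) (Finₚ.toℕ<n x))
    ... | β , 1≤β , β≤a , x∈β with pair-around 1≤β β≤a x∈β | window 1≤k k≤a 1≤β β≤a
    ... | p , p∈β , p+1∈β , x∈p | c , c+k≤a , c<β , β≤c+k = facet 1 i , IsShape⇒Facet shape , covers x∈p
      where open Through c+k≤a c<β β≤c+k p∈β p+1∈β

  module Counting (1≤k : 1 ≤ k) (m D : ℕ) (k*m≤a : k * m ≤ a) (s≤D : s ≤ D)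
    (wide : ∀ b → b < a → e b + D ≤ e (suc b)) where

    -- Pair j sits in block 1 + j m + β (0 ≤ β < m), at offset t ∈ [1, D - s] past the block's start.
    offsets : List (ℕ × ℕ)
    offsets = cartesianProduct (upTo m) (oneTo (D ∸ s))

    choices : List (ℕ × Vec (ℕ × ℕ) k)
    choices = cartesianProduct (oneTo s) (vectors k offsets)

    block : Vec (ℕ × ℕ) k → Fin k → ℕ
    block w j = toℕ j * m + proj₁ (Vec.lookup w j)

    start : Vec (ℕ × ℕ) k → Fin k → ℕ
    start w j = e (block w j) + proj₂ (Vec.lookup w j)

    chosenFacet : ℕ × Vec (ℕ × ℕ) k → Subset n
    chosenFacet (ℓ , w) = facet ℓ (start w)

    GoodOffset : ℕ × ℕ → Set
    GoodOffset (β , t) = β < m × 1 ≤ t × t ≤ D ∸ s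

    Chosen : ℕ × Vec (ℕ × ℕ) k → Set
    Chosen (ℓ , w) = 1 ≤ ℓ × ℓ ≤ s × ∀ j → GoodOffset (Vec.lookup w j)

    ∈-choices⁻ : ∀ {c} → c ∈ₗ choices → Chosen c
    ∈-choices⁻ c∈ = proj₁ (∈-oneTo⁻ ℓ∈) , proj₂ (∈-oneTo⁻ ℓ∈) , λ j → good (∈-vectors⁻ w∈ j)
      where
      ℓ∈ = proj₁ (∈-cartesianProduct⁻ (oneTo s) (vectors k offsets) c∈)
      w∈ = proj₂ (∈-cartesianProduct⁻ (oneTo s) (vectors k offsets) c∈)

      good : ∀ {o} → o ∈ₗ offsets → GoodOffset o
      good o∈ = ∈-upTo⁻ (proj₁ o∈′) , ∈-oneTo⁻ (proj₂ o∈′)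
        where o∈′ = ∈-cartesianProduct⁻ (upTo m) (oneTo (D ∸ s)) o∈

    block<a : ∀ w → (∀ j → GoodOffset (Vec.lookup w j)) → ∀ j → block w j < a
    block<a w good j = <-≤-trans (q<q′⇒q*m+r<q′*m+r′ 0 (Finₚ.toℕ<n j) (proj₁ (good j)))
                                 (≤-trans (≤-reflexive (+-identityʳ (k * m))) k*m≤a)

    offset-in-block : ∀ {c t} → c < a → 1 ≤ t → t ≤ D → InBlock e (suc c) (e c + t)
    offset-in-block {c} c<a 1≤t t≤D = m<m+n (e c) 1≤t , ≤-trans (+-monoʳ-≤ (e c) t≤D) (wide c c<a)

    chosen-shape : ∀ ℓ w → Chosen (ℓ , w) → IsShape ℓ (start w) (λ j → suc (block w j))
    chosen-shape ℓ w (1≤ℓ , ℓ≤s , good) =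
      1≤ℓ , ℓ≤s , (λ j j′ j<j′ → s≤s (q<q′⇒q*m+r<q′*m+r′ _ j<j′ (proj₁ (good j)))) , λ j →
        s≤s z≤n , block<a w good j ,
        offset-in-block (block<a w good j) (proj₁ (proj₂ (good j))) (≤-trans (proj₂ (proj₂ (good j))) (m∸n≤m D s)) ,
        subst (InBlock e _) (sym (+-assoc (e (block w j)) _ ℓ))
          (offset-in-block (block<a w good j) (≤-trans (proj₁ (proj₂ (good j))) (m≤m+n _ ℓ))
            (≤-trans (+-mono-≤ (proj₂ (proj₂ (good j))) ℓ≤s) (≤-reflexive (m∸n+n≡m s≤D))))

    module _ {ℓ ℓ′ w w′} (ch : Chosen (ℓ , w)) (ch′ : Chosen (ℓ′ , w′))
             (same : chosenFacet (ℓ , w) ≡ chosenFacet (ℓ′ , w′)) where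
      private
        module F = Shape (chosen-shape ℓ w ch)
        module G = Shape (chosen-shape ℓ′ w′ ch′)

      recognised : ∀ j → ∃ λ j′ → suc (block w′ j′) ≡ suc (block w j) × start w j ≡ start w′ j′ × ℓ ≡ ℓ′
      recognised j = G.pair-recognised (facet-describes ℓ′ (start w′)) F.1≤ℓ
        (subst (start w j ∈ˡ_) same (F.Pair⇒∈ˡ (facet-describes ℓ (start w)) (inj₁ refl)))
        (subst (start w j + ℓ ∈ˡ_) same (F.Pair⇒∈ˡ (facet-describes ℓ (start w)) (inj₂ refl)))
        (F.b≤a j) (F.Pair⇒InBlock (inj₁ refl)) (F.Pair⇒InBlock (inj₂ refl))

      -- Blocks of distinct pairs lie in disjoint ranges of length m, so pair j is recognised as pair j.
      same-block⇒same-offset : ∀ {j j′} → block w′ j′ ≡ block w j → start w j ≡ start w′ j′ →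
        Vec.lookup w j ≡ Vec.lookup w′ j
      same-block⇒same-offset {j} {j′} same-block same-start
        with quotient-remainder-unique (proj₁ (proj₂ (proj₂ ch′) j′)) (proj₁ (proj₂ (proj₂ ch) j)) same-block
      ... | j′≡j , β′≡β with Finₚ.toℕ-injective {i = j′} {j = j} j′≡j
      ... | refl = cong₂ _,_ (sym β′≡β)
        (+-cancelˡ-≡ (e (block w j)) _ _ (trans same-start (cong (λ β → e (toℕ j * m + β) + _) β′≡β)))

      same-offset : ∀ j → Vec.lookup w j ≡ Vec.lookup w′ j
      same-offset j = same-block⇒same-offset (suc-injective (proj₁ (proj₂ r))) (proj₁ (proj₂ (proj₂ r)))
        where r = recognised j

      chosenFacet-injective : (ℓ , w) ≡ (ℓ′ , w′)
      chosenFacet-injective = cong₂ _,_ (proj₂ (proj₂ (proj₂ (recognised (fromℕ< 1≤k))))) (lookup-extensional same-offset)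

    choices-unique : Unique choices
    choices-unique =
      cartesianProduct⁺ (oneTo-unique s) (vectors-unique k (cartesianProduct⁺ (upTo⁺ m) (oneTo-unique (D ∸ s))))

    length-choices : length choices ≡ s * (m * (D ∸ s)) ^ k
    length-choices = begin
      length choices                                ≡⟨ length-cartesianProductWith _,_ (oneTo s) (vectors k offsets) ⟩
      length (oneTo s) * length (vectors k offsets) ≡⟨ cong₂ _*_ (length-oneTo s) (length-vectors k offsets) ⟩
      s * length offsets ^ k                        ≡⟨ cong (λ l → s * l ^ k) length-offsets ⟩
      s * (m * (D ∸ s)) ^ k                         ∎
      where
      open ≡-Reasoning
      length-offsets : length offsets ≡ m * (D ∸ s)
      length-offsets = trans (length-cartesianProductWith _,_ (upTo m) (oneTo (D ∸ s)))
                             (cong₂ _*_ (length-upTo m) (length-oneTo (D ∸ s)))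

    facets-lower-bound : s * (m * (D ∸ s)) ^ k ≤ length facets
    facets-lower-bound = subst (_≤ length facets) length-choices
      (length-≤-by-injection chosenFacet choices-unique
        (λ {c} c∈ → ∈-facets⁺ (IsShape⇒Facet (chosen-shape (proj₁ c) (proj₂ c) (∈-choices⁻ c∈))))
        (λ c∈ c′∈ same → chosenFacet-injective (∈-choices⁻ c∈) (∈-choices⁻ c′∈) same))

m<n*[1+m/n] : ∀ m n .{{_ : NonZero n}} → m < n * suc (m / n)
m<n*[1+m/n] m n = begin-strict
  m                   ≡⟨ m≡m%n+[m/n]*n m n ⟩
  m % n + m / n * n   <⟨ +-monoˡ-< (m / n * n) (m%n<n m n) ⟩
  suc (m / n) * n     ≡⟨ *-comm (suc (m / n)) n ⟩
  n * suc (m / n)     ∎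
  where open ≤-Reasoning

m*n≤o⇒m≤o/n : ∀ m n {o} .{{_ : NonZero n}} → m * n ≤ o → m ≤ o / n
m*n≤o⇒m≤o/n m n m*n≤o = subst (_≤ _ / n) (m*n/n≡m m n) (/-monoˡ-≤ n m*n≤o)

x<y*[1+z]⇒x≤y*[2*z] : ∀ {x} y {z} → 1 ≤ z → x < y * suc z → x ≤ y * (2 * z)
x<y*[1+z]⇒x≤y*[2*z] y {z} 1≤z x<y*[1+z] =
  ≤-trans (<⇒≤ x<y*[1+z]) (*-monoʳ-≤ y (≤-trans (+-monoˡ-≤ z 1≤z) (≤-reflexive (cong (z +_) (sym (+-identityʳ z))))))

2*m≤n⇒n≤2*[n∸m] : ∀ m {n} → 2 * m ≤ n → n ≤ 2 * (n ∸ m)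
2*m≤n⇒n≤2*[n∸m] m {n} 2m≤n = begin
  n                      ≡⟨ m∸n+n≡m m≤n ⟨
  (n ∸ m) + m            ≤⟨ +-monoʳ-≤ (n ∸ m) (m+n≤o⇒m≤o∸n m (subst (_≤ n) (cong (m +_) (+-identityʳ m)) 2m≤n)) ⟩
  (n ∸ m) + (n ∸ m)      ≡⟨ cong ((n ∸ m) +_) (+-identityʳ (n ∸ m)) ⟨
  2 * (n ∸ m)            ∎
  where
  open ≤-Reasoning
  m≤n : m ≤ n
  m≤n = ≤-trans (m≤m+n m (m + 0)) 2m≤n

*-distribʳ-^ : ∀ c M k → (c * M) ^ k ≡ c ^ k * M ^ k
*-distribʳ-^ c M zero = refl
*-distribʳ-^ c M (suc k) =
  trans (cong ((c * M) *_) (*-distribʳ-^ c M k)) ([m*n]*[o*p]≡[m*o]*[n*p] c M (c ^ k) (M ^ k))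

n≤c*M⇒s*n^k≤c^k*[s*M^k] : ∀ {n c M} s k → n ≤ c * M → s * n ^ k ≤ c ^ k * (s * M ^ k)
n≤c*M⇒s*n^k≤c^k*[s*M^k] {n} {c} {M} s k n≤cM = begin
  s * n ^ k              ≤⟨ *-monoʳ-≤ s (^-monoˡ-≤ k n≤cM) ⟩
  s * (c * M) ^ k        ≡⟨ cong (s *_) (*-distribʳ-^ c M k) ⟩
  s * (c ^ k * M ^ k)    ≡⟨ x∙yz≈y∙xz s (c ^ k) (M ^ k) ⟩
  c ^ k * (s * M ^ k)    ∎
  where open ≤-Reasoning

-- Balanced partitions

balanced⇒block-size≥n/a : ∀ {n a e} .{{_ : NonZero a}} → BalancedPartition n a e →
  ∀ b → b < a → e b + n / a ≤ e (suc b)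
balanced⇒block-size≥n/a {n} {a} {e} (_ , _ , steps) b b<a = begin
  e b + n / a              ≤⟨ +-monoʳ-≤ (e b) (≤-pred n/a<1+size) ⟩
  e b + (e (suc b) ∸ e b)  ≡⟨ m+[n∸m]≡n (proj₁ (steps b b<a)) ⟩
  e (suc b)                ∎
  where
  open ≤-Reasoning
  n/a<1+size : n / a < suc (e (suc b) ∸ e b)
  n/a<1+size = *-cancelˡ-< a _ _ (begin-strict
    a * (n / a)                ≡⟨ *-comm a (n / a) ⟩
    n / a * a                  ≤⟨ m/n*n≤m n a ⟩
    n                          <⟨ proj₂ (proj₂ (steps b b<a)) ⟩
    a * (e (suc b) ∸ e b) + a  ≡⟨ +-comm _ a ⟩
    a + a * (e (suc b) ∸ e b)  ≡⟨ *-suc a _ ⟨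
    a * suc (e (suc b) ∸ e b)  ∎)

-- n < a (n/a + 1) ≤ 2 a (n/a),  a < k (a/k + 1) ≤ 2 k (a/k)  and  n/a ≤ 2 (n/a - s).
n≤8k*[a/k*[n/a∸s]] : ∀ {n a k s} .{{_ : NonZero a}} .{{_ : NonZero k}} →
  k ≤ a → 1 ≤ s → 2 * s ≤ n / a → n ≤ 8 * k * (a / k * (n / a ∸ s))
n≤8k*[a/k*[n/a∸s]] {n} {a} {k} {s} k≤a 1≤s 2s≤n/a = begin
  n                                          ≤⟨ x<y*[1+z]⇒x≤y*[2*z] a 1≤n/a (m<n*[1+m/n] n a) ⟩
  a * (2 * (n / a))                          ≤⟨ *-mono-≤ (x<y*[1+z]⇒x≤y*[2*z] k (m≥n⇒m/n>0 k≤a) (m<n*[1+m/n] a k))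
                                                          (*-monoʳ-≤ 2 (2*m≤n⇒n≤2*[n∸m] s 2s≤n/a)) ⟩
  k * (2 * (a / k)) * (2 * (2 * (n / a ∸ s))) ≡⟨ regroup k (a / k) (n / a ∸ s) ⟩
  8 * k * (a / k * (n / a ∸ s))              ∎
  where
  open ≤-Reasoning
  1≤n/a : 1 ≤ n / a
  1≤n/a = ≤-trans (≤-trans 1≤s (m≤n*m s 2)) 2s≤n/a
  regroup : ∀ k m d → k * (2 * m) * (2 * (2 * d)) ≡ 8 * k * (m * d)
  regroup = solve-∀

pseudomanifold-with-facet-bounds : ∀ {k n a s e} → 2 ≤ k → 1 ≤ s → k ≤ a → 4 * (a * s) ≤ n →
  BalancedPartition n a e →
  IsPseudomanifoldWithVertices n (2 * k ∸ 1) (IsFacet k n a s e) ×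
  Σ (List (Subset n)) λ fs → EnumeratesFacets (IsFacet k n a s e) fs ×
    s * n ^ k ≤ (8 * k) ^ k * length fs × length fs ≤ 1 * (s * n ^ k)
pseudomanifold-with-facet-bounds {k} {n} {a} {s} {e} 2≤k 1≤s k≤a 4as≤n balanced@(e[0]≡0 , e[a]≡n , steps) =
  ((λ _ → facet-size 1≤k) , every-vertex-in-a-facet , ridges-in-at-most-two-facets 2≤k) ,
  facets , facets-enumerate ,
  ≤-trans (n≤c*M⇒s*n^k≤c^k*[s*M^k] s k (n≤8k*[a/k*[n/a∸s]] k≤a 1≤s 2s≤n/a))
          (*-monoʳ-≤ ((8 * k) ^ k) facets-lower-bound) ,
  subst (length facets ≤_) (sym (*-identityˡ (s * n ^ k))) length-facets≤
  where
  1≤k : 1 ≤ k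
  1≤k = ≤-trans (s≤s z≤n) 2≤k

  instance
    k≢0 : NonZero k
    k≢0 = >-nonZero 1≤k
    a≢0 : NonZero a
    a≢0 = >-nonZero (≤-trans 1≤k k≤a)

  4s≤n/a : 4 * s ≤ n / a
  4s≤n/a = m*n≤o⇒m≤o/n (4 * s) a (subst (_≤ n) (trans (cong (4 *_) (*-comm a s)) (sym (*-assoc 4 s a))) 4as≤n)

  2s≤n/a : 2 * s ≤ n / a
  2s≤n/a = ≤-trans (*-monoˡ-≤ s {2} {4} (s≤s (s≤s z≤n))) 4s≤n/a

  wide : ∀ b → b < a → e b + n / a ≤ e (suc b)
  wide = balanced⇒block-size≥n/a balanced

  long : ∀ b → b < a → 2 + e b ≤ e (suc b)
  long b b<a = begin
    2 + e b      ≡⟨ +-comm 2 (e b) ⟩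
    e b + 2      ≤⟨ +-monoʳ-≤ (e b) (≤-trans (*-monoʳ-≤ 2 1≤s) 2s≤n/a) ⟩
    e b + n / a  ≤⟨ wide b b<a ⟩
    e (suc b)    ∎
    where open ≤-Reasoning

  open Complex k n a s e (λ b b<a → proj₁ (steps b b<a)) e[a]≡n
  open Covering 1≤k k≤a 1≤s e[0]≡0 long
  open Counting 1≤k (a / k) (n / a) (subst (_≤ a) (*-comm (a / k) k) (m/n*n≤m a k)) (≤-trans (m≤n*m s 4) 4s≤n/a) wide

lemma3p10 : (k : ℕ) → 2 ≤ k → (a s : ℕ → ℕ) →
    (∀ n → 1 ≤ a n) → (∀ n → 1 ≤ s n) →
    LittleO a (λ n → n) → LittleO (λ n → a n * s n) (λ n → n) →
    TendsToInfinity a → TendsToInfinity s →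
    Σ ℕ λ c₁ → Σ ℕ λ c₂ → 1 ≤ c₁ × 1 ≤ c₂ × Σ ℕ λ N →
      ∀ n → N ≤ n → (e : ℕ → ℕ) → BalancedPartition n (a n) e →
        IsPseudomanifoldWithVertices n (2 * k ∸ 1) (IsFacet k n (a n) (s n) e) ×
        Σ (List (Subset n)) λ fs → EnumeratesFacets (IsFacet k n (a n) (s n) e) fs ×
          s n * n ^ k ≤ c₁ * length fs × length fs ≤ c₂ * (s n * n ^ k)
lemma3p10 k 2≤k a s _ 1≤s _ as=o[n] a→∞ _ =
  (8 * k) ^ k , 1 , m^n>0 (8 * k) {{>-nonZero 0<8k}} k , ≤-refl , N₁ + N₂ ,
  λ n N≤n e balanced → pseudomanifold-with-facet-bounds 2≤k (1≤s n)
    (proj₂ (a→∞ k) n (≤-trans (m≤m+n N₁ N₂) N≤n))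
    (proj₂ (as=o[n] 4) n (≤-trans (m≤n+m N₂ N₁) N≤n))
    balanced
  where
  N₁ N₂ : ℕ
  N₁ = proj₁ (a→∞ k)
  N₂ = proj₁ (as=o[n] 4)

  0<8k : 0 < 8 * k
  0<8k = ≤-trans (s≤s z≤n) (*-monoʳ-≤ 8 (≤-trans (s≤s z≤n) 2≤k))
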